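{- Let $n\ge1$ and $r\in \mathbb{N}_0$. If $r = 0$, then $X_{n;0}^{L} = n$ deterministically. For $r > 0$, every simple two-dimensional lattice path of length $n$ satisfies \[ [\![ n > 1 \text{ and } r=1 ]\!] \leq X_{n;r}^{L} \leq \Big\lfloor \frac{n}{2^{r}}\Big\rfloor, \] and these bounds are sharp, i.e. for each $n$ both bounds are attained by some path of length $n$.
   Context: A simple two-dimensional lattice path of length $n\ge1$ is a word of length $n$ over $\{\uparrow,\rightarrow,\downarrow,\leftarrow\}$. Horizontal steps are $\rightarrow,\leftarrow$, vertical steps $\uparrow,\downarrow$. The reduction $\Phi_L$ on paths of length $\ge2$: (1) if the path starts with a vertical step, rotate the whole path by $90^\circ$ clockwise; (2) if the resulting path ends with a horizontal step, rotate that last step by $90^\circ$ clockwise; the path then decomposes uniquely into segments, each a nonempty run of horizontal steps followed by a nonempty run of vertical steps; (3) replace each segment by $\nearrow$ (starts with $\rightarrow$, first vertical step $\uparrow$), $\searrow$ ($\rightarrow$, $\downarrow$), $\swarrow$ ($\leftarrow$, $\downarrow$), or $\nwarrow$ ($\leftarrow$, $\uparrow$); (4) rotate by $45^\circ$ clockwise: $\nearrow\mapsto\rightarrow$, $\searrow\mapsto\downarrow$, $\swarrow\mapsto\leftarrow$, $\nwarrow\mapsto\uparrow$. $\Phi_L$ is undefined on single steps. The $r$th fringe size of a path $\ell$ is the length of $\Phi_L^r(\ell)$ if $\Phi_L$ can be applied $r$ times to $\ell$, and $0$ otherwise; $X^L_{n;r}$ denotes the $r$th fringe size of a path of length $n$.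 $[\![P]\!]$ is $1$ if $P$ holds and $0$ otherwise. -}

module Defs where

open import Data.Nat using (ℕ; zero; suc; _/_; _^_)
open import Data.Nat.Properties using (m^n≢0)
open import Data.Bool using (Bool; true; false; if_then_else_; _∧_)
open import Data.List using (List; []; _∷_; length; map)
open import Data.Maybe using (Maybe; just; nothing; maybe)
open import Relation.Nullary.Decidable using (⌊_⌋)
open import Data.Nat using (_≤?_; _≟_)

data Step : Set where
  up right down left : Step

Path : Set
Path = List Step

isHorizontal : Step → Bool
isHorizontal right = true
isHorizontal left  = true
isHorizontal up    = false
isHorizontal down  = false

rot : Step → Step
rot up    = right
rot right = down
rot down  = left
rot left  = up

normStart : Path → Path
normStart [] = []
normStart (x ∷ xs) = if isHorizontal x then x ∷ xs else map rot (x ∷ xs)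

normEnd : Path → Path
normEnd [] = []
normEnd (x ∷ []) = (if isHorizontal x then rot x else x) ∷ []
normEnd (x ∷ y ∷ zs) = x ∷ normEnd (y ∷ zs)

-- steps (3)+(4): a segment with first horizontal step h and first vertical
-- step v is replaced by ↗,↘,↙,↖ and then rotated 45° clockwise.
segSymbol : Step → Step → Step
segSymbol right up   = right   -- ↗ ↦ →
segSymbol right down = down    -- ↘ ↦ ↓
segSymbol left  down = left    -- ↙ ↦ ←
segSymbol left  up   = up      -- ↖ ↦ ↑
segSymbol _     _    = up      -- unreachable on normalised paths

mutual
  -- inside the horizontal run of a segment whose first step is h
  inHoriz : Step → Path → Path
  inHoriz h [] = []
  inHoriz h (x ∷ xs) = if isHorizontal x then inHoriz h xs
                       else segSymbol h x ∷ inVert xs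

  -- inside the vertical run of a segment (already emitted)
  inVert : Path → Path
  inVert [] = []
  inVert (x ∷ xs) = if isHorizontal x then inHoriz x xs else inVert xs

segments : Path → Path
segments [] = []
segments (x ∷ xs) = inHoriz x xs

ΦL : Path → Maybe Path
ΦL [] = nothing
ΦL (x ∷ []) = nothing
ΦL (x ∷ y ∷ zs) = just (segments (normEnd (normStart (x ∷ y ∷ zs))))

ΦL^ : ℕ → Path → Maybe Path
ΦL^ zero ℓ = just ℓ
ΦL^ (suc r) ℓ with ΦL ℓ
... | nothing = nothing
... | just ℓ′ = ΦL^ r ℓ′

fringe : ℕ → Path → ℕ
fringe r ℓ = maybe length 0 (ΦL^ r ℓ)

lowerBound : ℕ → ℕ → ℕ
lowerBound n r = if ⌊ 2 ≤? n ⌋ ∧ ⌊ r ≟ 1 ⌋ then 1 else 0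

upperBound : ℕ → ℕ → ℕ
upperBound n r = _/_ n (2 ^ r) {{m^n≢0 2 r}}

-- Φ_L maps each segment, which has at least two steps, to a single step, so it at least
-- halves the length; iterating gives X_{n;r} ≤ ⌊n/2^r⌋.  Conversely every path s ∷ p is
-- the image of the path that spells each step of s ∷ p as a two-step segment, with one
-- extra horizontal step in front when n is odd; iterating this preimage construction
-- reaches length n with r-th fringe size exactly ⌊n/2^r⌋.  For the lower bound, the
-- normalised path ends with a vertical step, so it contains at least one segment.
module Submission where

open import Defs
open import Data.Nat using (ℕ; zero; suc; _+_; _*_; _/_; _%_; _^_; _≤_; _<_; z≤n; s≤s)
open import Data.Nat.Properties
  using (≤-reflexive; m≤n⇒m≤1+n; n≤0⇒n≡0; +-suc; +-comm; m^n≢0; module ≤-Reasoning)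
open import Data.Nat.DivMod using (m≡m%n+[m/n]*n; n/1≡n; m*n/n≡m; /-monoˡ-≤; m/n/o≡m/[n*o]; 0/n≡0)
open import Data.List using ([]; _∷_; length; map; replicate; _++_)
open import Data.List.Properties using (length-map; length-++; length-replicate)
open import Data.Bool using (true)
open import Data.Maybe using (just; nothing)
open import Data.Product using (_×_; ∃-syntax; _,_)
open import Relation.Binary.PropositionalEquality
  using (_≡_; refl; sym; trans; cong; subst; module ≡-Reasoning)

length-normStart : ∀ ℓ → length (normStart ℓ) ≡ length ℓ
length-normStart []          = refl
length-normStart (up ∷ ℓ)    = length-map rot (up ∷ ℓ)
length-normStart (down ∷ ℓ)  = length-map rot (down ∷ ℓ)
length-normStart (right ∷ ℓ) = refl
length-normStart (left ∷ ℓ)  = refl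

length-normEnd : ∀ ℓ → length (normEnd ℓ) ≡ length ℓ
length-normEnd []          = refl
length-normEnd (x ∷ [])    = refl
length-normEnd (x ∷ y ∷ ℓ) = cong suc (length-normEnd (y ∷ ℓ))

mutual
  length-inHoriz : ∀ h ℓ → length (inHoriz h ℓ) * 2 ≤ suc (length ℓ)
  length-inHoriz h []            = z≤n
  length-inHoriz h (up ∷ ℓ)      = s≤s (s≤s (length-inVert ℓ))
  length-inHoriz h (down ∷ ℓ)    = s≤s (s≤s (length-inVert ℓ))
  length-inHoriz h (right ∷ ℓ)   = m≤n⇒m≤1+n (length-inHoriz h ℓ)
  length-inHoriz h (left ∷ ℓ)    = m≤n⇒m≤1+n (length-inHoriz h ℓ)

  length-inVert : ∀ ℓ → length (inVert ℓ) * 2 ≤ length ℓ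
  length-inVert []            = z≤n
  length-inVert (up ∷ ℓ)      = m≤n⇒m≤1+n (length-inVert ℓ)
  length-inVert (down ∷ ℓ)    = m≤n⇒m≤1+n (length-inVert ℓ)
  length-inVert (right ∷ ℓ)   = length-inHoriz right ℓ
  length-inVert (left ∷ ℓ)    = length-inHoriz left ℓ

length-segments : ∀ ℓ → length (segments ℓ) * 2 ≤ length ℓ
length-segments []      = z≤n
length-segments (x ∷ ℓ) = length-inHoriz x ℓ

length-ΦL : ∀ {ℓ ℓ′} → ΦL ℓ ≡ just ℓ′ → length ℓ′ * 2 ≤ length ℓ
length-ΦL {x ∷ y ∷ ℓ} refl = begin
  length (segments (normEnd (normStart (x ∷ y ∷ ℓ)))) * 2
    ≤⟨ length-segments (normEnd (normStart (x ∷ y ∷ ℓ))) ⟩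
  length (normEnd (normStart (x ∷ y ∷ ℓ)))
    ≡⟨ length-normEnd (normStart (x ∷ y ∷ ℓ)) ⟩
  length (normStart (x ∷ y ∷ ℓ))
    ≡⟨ length-normStart (x ∷ y ∷ ℓ) ⟩
  length (x ∷ y ∷ ℓ) ∎
  where open ≤-Reasoning

fringe-suc : ∀ r {ℓ ℓ′} → ΦL ℓ ≡ just ℓ′ → fringe (suc r) ℓ ≡ fringe r ℓ′
fringe-suc r {ℓ} eq with ΦL ℓ
fringe-suc r refl | just _ = refl

upperBound-zero : ∀ n → upperBound n 0 ≡ n
upperBound-zero = n/1≡n

upperBound-zeroˡ : ∀ r → upperBound 0 r ≡ 0
upperBound-zeroˡ r = 0/n≡0 (2 ^ r) {{m^n≢0 2 r}}

upperBound-suc : ∀ n r → upperBound n (suc r) ≡ upperBound (n / 2) r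
upperBound-suc n r = sym (m/n/o≡m/[n*o] n 2 (2 ^ r) {{_}} {{m^n≢0 2 r}} {{m^n≢0 2 (suc r)}})

upperBound-monoˡ-≤ : ∀ {m n} r → m ≤ n → upperBound m r ≤ upperBound n r
upperBound-monoˡ-≤ r = /-monoˡ-≤ (2 ^ r) {{m^n≢0 2 r}}

m*2≤n⇒m≤n/2 : ∀ {m n} → m * 2 ≤ n → m ≤ n / 2
m*2≤n⇒m≤n/2 {m} m*2≤n = subst (_≤ _) (m*n/n≡m m 2) (/-monoˡ-≤ 2 m*2≤n)

fringe≤upperBound : ∀ r ℓ → fringe r ℓ ≤ upperBound (length ℓ) r
fringe≤upperBound zero    ℓ = ≤-reflexive (sym (upperBound-zero (length ℓ)))
fringe≤upperBound (suc r) ℓ with ΦL ℓ in eq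
... | nothing = z≤n
... | just ℓ′ = begin
  fringe r ℓ′                      ≤⟨ fringe≤upperBound r ℓ′ ⟩
  upperBound (length ℓ′) r         ≤⟨ upperBound-monoˡ-≤ r (m*2≤n⇒m≤n/2 (length-ΦL eq)) ⟩
  upperBound (length ℓ / 2) r      ≡⟨ upperBound-suc (length ℓ) r ⟨
  upperBound (length ℓ) (suc r)    ∎
  where open ≤-Reasoning

inHoriz-normEnd-nonempty : ∀ h y ℓ → 1 ≤ length (inHoriz h (normEnd (y ∷ ℓ)))
inHoriz-normEnd-nonempty h up    []      = s≤s z≤n
inHoriz-normEnd-nonempty h down  []      = s≤s z≤n
inHoriz-normEnd-nonempty h right []      = s≤s z≤n
inHoriz-normEnd-nonempty h left  []      = s≤s z≤n
inHoriz-normEnd-nonempty h up    (z ∷ ℓ) = s≤s z≤n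
inHoriz-normEnd-nonempty h down  (z ∷ ℓ) = s≤s z≤n
inHoriz-normEnd-nonempty h right (z ∷ ℓ) = inHoriz-normEnd-nonempty h z ℓ
inHoriz-normEnd-nonempty h left  (z ∷ ℓ) = inHoriz-normEnd-nonempty h z ℓ

fringe-one-nonempty : ∀ x y ℓ → 1 ≤ fringe 1 (x ∷ y ∷ ℓ)
fringe-one-nonempty up    y ℓ = inHoriz-normEnd-nonempty right (rot y) (map rot ℓ)
fringe-one-nonempty down  y ℓ = inHoriz-normEnd-nonempty left  (rot y) (map rot ℓ)
fringe-one-nonempty right y ℓ = inHoriz-normEnd-nonempty right y ℓ
fringe-one-nonempty left  y ℓ = inHoriz-normEnd-nonempty left  y ℓ

-- On lengths 0 and 1 the bracket [n > 1 ∧ r = 1] computes to 0, on longer ones to [r = 1].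
lowerBound≤fringe : ∀ r ℓ → lowerBound (length ℓ) r ≤ fringe r ℓ
lowerBound≤fringe r             []          = z≤n
lowerBound≤fringe r             (x ∷ [])    = z≤n
lowerBound≤fringe zero          (x ∷ y ∷ ℓ) = z≤n
lowerBound≤fringe (suc zero)    (x ∷ y ∷ ℓ) = fringe-one-nonempty x y ℓ
lowerBound≤fringe (suc (suc r)) (x ∷ y ∷ ℓ) = z≤n

-- The two-step segment that Φ_L turns into s.
segH segV : Step → Step
segH up    = left
segH right = right
segH down  = right
segH left  = left
segV up    = up
segV right = up
segV down  = down
segV left  = down

expand : Path → Path
expand []      = []
expand (s ∷ p) = segH s ∷ segV s ∷ expand p

preimage : ℕ → Step → Path → Path
preimage k s p = segH s ∷ replicate k (segH s) ++ segV s ∷ expand p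

length-expand : ∀ p → length (expand p) ≡ length p * 2
length-expand []      = refl
length-expand (s ∷ p) = cong (λ m → suc (suc m)) (length-expand p)

length-preimage : ∀ k s p → length (preimage k s p) ≡ k + length (s ∷ p) * 2
length-preimage k s p = begin
  suc (length (replicate k (segH s) ++ segV s ∷ expand p))
    ≡⟨ cong suc (length-++ (replicate k (segH s))) ⟩
  suc (length (replicate k (segH s)) + suc (length (expand p)))
    ≡⟨ cong (λ m → suc (m + suc (length (expand p)))) (length-replicate k) ⟩
  suc (k + suc (length (expand p)))
    ≡⟨ cong (λ m → suc (k + suc m)) (length-expand p) ⟩
  suc (k + suc (length p * 2))
    ≡⟨ +-suc k (suc (length p * 2)) ⟨
  k + length (s ∷ p) * 2 ∎
  where open ≡-Reasoning

normEnd-++ : ∀ xs y ℓ → normEnd (xs ++ y ∷ ℓ) ≡ xs ++ normEnd (y ∷ ℓ)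
normEnd-++ []           y ℓ = refl
normEnd-++ (x ∷ [])     y ℓ = refl
normEnd-++ (x ∷ x′ ∷ xs) y ℓ = cong (x ∷_) (normEnd-++ (x′ ∷ xs) y ℓ)

normEnd-segV-expand : ∀ s p → normEnd (segV s ∷ expand p) ≡ segV s ∷ expand p
normEnd-segV-expand up    []      = refl
normEnd-segV-expand down  []      = refl
normEnd-segV-expand right []      = refl
normEnd-segV-expand left  []      = refl
normEnd-segV-expand s     (t ∷ p) = cong (λ ℓ → segV s ∷ segH t ∷ ℓ) (normEnd-segV-expand t p)

inVert-expand : ∀ p → inVert (expand p) ≡ p
inVert-expand []          = refl
inVert-expand (up ∷ p)    = cong (up ∷_)    (inVert-expand p)
inVert-expand (down ∷ p)  = cong (down ∷_)  (inVert-expand p)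
inVert-expand (right ∷ p) = cong (right ∷_) (inVert-expand p)
inVert-expand (left ∷ p)  = cong (left ∷_)  (inVert-expand p)

inHoriz-segH-replicate : ∀ s k ℓ → inHoriz (segH s) (replicate k (segH s) ++ ℓ) ≡ inHoriz (segH s) ℓ
inHoriz-segH-replicate s     zero    ℓ = refl
inHoriz-segH-replicate up    (suc k) ℓ = inHoriz-segH-replicate up    k ℓ
inHoriz-segH-replicate down  (suc k) ℓ = inHoriz-segH-replicate down  k ℓ
inHoriz-segH-replicate right (suc k) ℓ = inHoriz-segH-replicate right k ℓ
inHoriz-segH-replicate left  (suc k) ℓ = inHoriz-segH-replicate left  k ℓ

inHoriz-segment : ∀ s p → inHoriz (segH s) (segV s ∷ expand p) ≡ s ∷ p
inHoriz-segment up    p = cong (up ∷_)    (inVert-expand p)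
inHoriz-segment down  p = cong (down ∷_)  (inVert-expand p)
inHoriz-segment right p = cong (right ∷_) (inVert-expand p)
inHoriz-segment left  p = cong (left ∷_)  (inVert-expand p)

ΦL-horizontal : ∀ x xs y ℓ → isHorizontal x ≡ true →
                ΦL (x ∷ xs ++ y ∷ ℓ) ≡ just (inHoriz x (normEnd (xs ++ y ∷ ℓ)))
ΦL-horizontal right []       y ℓ refl = refl
ΦL-horizontal right (_ ∷ xs) y ℓ refl = refl
ΦL-horizontal left  []       y ℓ refl = refl
ΦL-horizontal left  (_ ∷ xs) y ℓ refl = refl

isHorizontal-segH : ∀ s → isHorizontal (segH s) ≡ true
isHorizontal-segH up    = refl
isHorizontal-segH down  = refl
isHorizontal-segH right = refl
isHorizontal-segH left  = refl

ΦL-preimage : ∀ k s p → ΦL (preimage k s p) ≡ just (s ∷ p)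
ΦL-preimage k s p = begin
  ΦL (preimage k s p)
    ≡⟨ ΦL-horizontal (segH s) (replicate k (segH s)) (segV s) (expand p) (isHorizontal-segH s) ⟩
  just (inHoriz (segH s) (normEnd (replicate k (segH s) ++ segV s ∷ expand p)))
    ≡⟨ cong (λ ℓ → just (inHoriz (segH s) ℓ)) (normEnd-++ (replicate k (segH s)) (segV s) (expand p)) ⟩
  just (inHoriz (segH s) (replicate k (segH s) ++ normEnd (segV s ∷ expand p)))
    ≡⟨ cong (λ ℓ → just (inHoriz (segH s) (replicate k (segH s) ++ ℓ))) (normEnd-segV-expand s p) ⟩
  just (inHoriz (segH s) (replicate k (segH s) ++ segV s ∷ expand p))
    ≡⟨ cong just (inHoriz-segH-replicate s k (segV s ∷ expand p)) ⟩
  just (inHoriz (segH s) (segV s ∷ expand p))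
    ≡⟨ cong just (inHoriz-segment s p) ⟩
  just (s ∷ p) ∎
  where open ≡-Reasoning

upperBound-attained : ∀ r n → ∃[ ℓ ] (length ℓ ≡ n × fringe r ℓ ≡ upperBound n r)
upperBound-attained zero n =
  replicate n right , length-replicate n , trans (length-replicate n) (sym (upperBound-zero n))
upperBound-attained (suc r) n with upperBound-attained r (n / 2)
... | [] , 0≡n/2 , _ = replicate n right , length-replicate n , trans fringe≡0 (sym upperBound≡0)
  where
  upperBound≡0 : upperBound n (suc r) ≡ 0
  upperBound≡0 = begin
    upperBound n (suc r)   ≡⟨ upperBound-suc n r ⟩
    upperBound (n / 2) r   ≡⟨ cong (λ m → upperBound m r) 0≡n/2 ⟨
    upperBound 0 r         ≡⟨ upperBound-zeroˡ r ⟩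
    0 ∎
    where open ≡-Reasoning
  fringe≡0 : fringe (suc r) (replicate n right) ≡ 0
  fringe≡0 = n≤0⇒n≡0 (begin
    fringe (suc r) (replicate n right)                      ≤⟨ fringe≤upperBound (suc r) (replicate n right) ⟩
    upperBound (length (replicate n right)) (suc r)         ≡⟨ cong (λ m → upperBound m (suc r)) (length-replicate n) ⟩
    upperBound n (suc r)                                    ≡⟨ upperBound≡0 ⟩
    0 ∎)
    where open ≤-Reasoning
... | s ∷ p , length≡n/2 , fringe≡ = preimage (n % 2) s p , length≡n , fringe≡′
  where
  length≡n : length (preimage (n % 2) s p) ≡ n
  length≡n = begin
    length (preimage (n % 2) s p) ≡⟨ length-preimage (n % 2) s p ⟩
    n % 2 + length (s ∷ p) * 2    ≡⟨ cong (λ m → n % 2 + m * 2) length≡n/2 ⟩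
    n % 2 + n / 2 * 2             ≡⟨ m≡m%n+[m/n]*n n 2 ⟨
    n ∎
    where open ≡-Reasoning
  fringe≡′ : fringe (suc r) (preimage (n % 2) s p) ≡ upperBound n (suc r)
  fringe≡′ = begin
    fringe (suc r) (preimage (n % 2) s p) ≡⟨ fringe-suc r (ΦL-preimage (n % 2) s p) ⟩
    fringe r (s ∷ p)                      ≡⟨ fringe≡ ⟩
    upperBound (n / 2) r                  ≡⟨ upperBound-suc n r ⟨
    upperBound n (suc r) ∎
    where open ≡-Reasoning

lowerBound-attained : ∀ r n → ∃[ ℓ ] (length ℓ ≡ n × fringe (suc r) ℓ ≡ lowerBound n (suc r))
lowerBound-attained r zero          = [] , refl , refl
lowerBound-attained r (suc zero)    = right ∷ [] , refl , refl
lowerBound-attained r (suc (suc m)) =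
  preimage m right [] , trans (length-preimage m right []) (+-comm m 2) ,
  trans (fringe-suc r (ΦL-preimage m right [])) (fringe-single r)
  where
  fringe-single : ∀ r → fringe r (right ∷ []) ≡ lowerBound (suc (suc m)) (suc r)
  fringe-single zero    = refl
  fringe-single (suc r) = refl

proposition3p9 : (n r : ℕ) → 1 ≤ n →
    (r ≡ 0 → (ℓ : Path) → length ℓ ≡ n → fringe 0 ℓ ≡ n)
    × (0 < r →
        ((ℓ : Path) → length ℓ ≡ n →
            lowerBound n r ≤ fringe r ℓ × fringe r ℓ ≤ upperBound n r)
        × (∃[ ℓ ] (length ℓ ≡ n × fringe r ℓ ≡ lowerBound n r))
        × (∃[ ℓ ] (length ℓ ≡ n × fringe r ℓ ≡ upperBound n r)))
proposition3p9 n zero    _ = (λ _ _ length≡n → length≡n) , λ ()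
proposition3p9 n (suc r) _ =
  (λ ()) , λ _ → bounds , lowerBound-attained r n , upperBound-attained (suc r) n
  where
  bounds : ∀ ℓ → length ℓ ≡ n → lowerBound n (suc r) ≤ fringe (suc r) ℓ × fringe (suc r) ℓ ≤ upperBound n (suc r)
  bounds ℓ length≡n rewrite sym length≡n = lowerBound≤fringe (suc r) ℓ , fringe≤upperBound (suc r) ℓ
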